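{- Let $\mathcal C$ be any collection of languages over a countably infinite universe $U$ and let $i \ge 1$ be an integer. The following are equivalent: (1) $\mathrm{NC}_1(\mathcal C) < \infty$; (2) $\mathcal C$ is uniformly generatable with noise level $i$; (3) $\mathcal C$ is uniformly noise-dependently generatable. However, there exists a collection that is uniformly generatable without noise (i.e., with noise level $0$), but is not uniformly generatable with noise level $1$.
   Context: A language is an infinite subset of $U$; a collection is a (possibly uncountable) set of languages. For $i \in \mathbb N=\{0,1,\dots\}$, an enumeration of a language $K$ with noise level $i$ is an infinite sequence $x_0, x_1, \dots$ of elements of $U$ without repetitions such that $K \subseteq \{x_j : j \in \mathbb N\}$ and $|\{x_j : j\in\mathbb N\} \setminus K| \le i$ (noise level $0$ is an ordinary enumeration of $K$). Write $S_t = \{x_0,\dots,x_t\}$. A generator algorithm is a function $G : U^* \to U$; at time $t$ it outputs $z_t = G(x_0,\dots,x_t)$. $G$ uniformly generates with noise level $i$ for $\mathcal C$ if there exists $t^\star$ such that for every $K \in \mathcal C$, every enumeration of $K$ with noise level at most $i$, and all $t\ge t^\star$, $z_t \in K\setminus S_t$. $G$ uniformly noise-dependently generates for $\mathcal C$ if for every $n^\star \in \mathbb N$ there exists $t^\star$ such that for every $K\in\mathcal C$, every enumeration of $K$ with noise level $n^\star$, and all $t \ge t^\star$, $z_t \in K\setminus S_t$. A collection is generatable in a given sense if such an algorithm exists. For $S \subseteq U$, $\mathcal C(S,i) = \{L \in \mathcal C : |S\setminus L| \le i\}$; $\langle S\rangle_{\mathcal C,i} = \bigcap_{L\in\mathcal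 C(S,i)} L$ if $\mathcal C(S,i)\neq\emptyset$, else $\emptyset$. $\mathrm{NC}_i(\mathcal C)$ is the size of the largest finite set $S$ with $\mathcal C(S,i)\neq\emptyset$ and $|\langle S\rangle_{\mathcal C,i}|<\infty$, and $\infty$ if there are arbitrarily large such sets. -}

module Defs where

open import Level using (0ℓ) renaming (suc to lsuc)
open import Data.Nat using (ℕ; suc; _≤_)
open import Data.List using (List; length; applyUpTo)
open import Data.List.Membership.Propositional using (_∈_)
open import Data.Product using (Σ; ∃; _×_)
open import Relation.Nullary using (¬_)
open import Data.List.Relation.Unary.Unique.Propositional using (Unique)
open import Relation.Binary.PropositionalEquality using (_≡_; _≢_)

module _ {U : Set} where

  Subset : Set₁
  Subset = U → Set

  Finite : Subset → Set
  Finite P = Σ (List U) λ xs → ∀ x → P x → x ∈ xs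

  Infinite : Subset → Set
  Infinite P = ¬ Finite P

  AtMost : ℕ → Subset → Set
  AtMost n P = Σ (List U) λ xs → (length xs ≤ n) × (∀ x → P x → x ∈ xs)

  Collection : Set₁
  Collection = Subset → Set

  IsCollectionOfLanguages : Collection → Set₁
  IsCollectionOfLanguages C = ∀ L → C L → Infinite L

  Range : (ℕ → U) → Subset
  Range x u = ∃ λ j → x j ≡ u

  EnumerationWithNoise : ℕ → Subset → (ℕ → U) → Set
  EnumerationWithNoise i K x =
    (∀ j k → x j ≡ x k → j ≡ k)
    × (∀ u → K u → Range x u)
    × AtMost i (λ u → Range x u × ¬ K u)

  Generator : Set
  Generator = List U → U

  output : Generator → (ℕ → U) → ℕ → U
  output G x t = G (applyUpTo x (suc t))

  GeneratesAt : Generator → Subset → (ℕ → U) → ℕ → Set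
  GeneratesAt G K x t =
    K (output G x t) × (∀ j → j ≤ t → output G x t ≢ x j)

  UniformlyGeneratesWithNoise : ℕ → Collection → Generator → Set₁
  UniformlyGeneratesWithNoise i C G =
    Σ ℕ λ t⋆ → ∀ K → C K → ∀ x → EnumerationWithNoise i K x →
      ∀ t → t⋆ ≤ t → GeneratesAt G K x t

  UniformlyGeneratableWithNoise : ℕ → Collection → Set₁
  UniformlyGeneratableWithNoise i C =
    Σ Generator λ G → UniformlyGeneratesWithNoise i C G

  UniformlyNoiseDependentlyGeneratable : Collection → Set₁
  UniformlyNoiseDependentlyGeneratable C =
    Σ Generator λ G → ∀ (n⋆ : ℕ) → Σ ℕ λ t⋆ →
      ∀ K → C K → ∀ x → EnumerationWithNoise n⋆ K x →
        ∀ t → t⋆ ≤ t → GeneratesAt G K x t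

  CloseTo : ℕ → List U → Subset → Set
  CloseTo i S L = AtMost i (λ u → (u ∈ S) × ¬ L u)

  CSNonEmpty : Collection → List U → ℕ → Set₁
  CSNonEmpty C S i = Σ Subset λ L → C L × CloseTo i S L

  Closure : Collection → List U → ℕ → U → Set₁
  Closure C S i u = CSNonEmpty C S i × (∀ L → C L → CloseTo i S L → L u)

  FiniteSet₁ : (U → Set₁) → Set₁
  FiniteSet₁ P = Σ (List U) λ xs → ∀ x → P x → x ∈ xs

  -- finite sets S are represented by duplicate-free lists; |S| = length
  NoDup : List U → Set
  NoDup S = Unique S

  NCFinite : ℕ → Collection → Set₁
  NCFinite i C =
    Σ ℕ λ n → ∀ (S : List U) → NoDup S → CSNonEmpty C S i →
      FiniteSet₁ (Closure C S i) → length S ≤ n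

{-# OPTIONS --safe #-}
module Submission where

-- If NC₁(𝒞) ≤ d then every NC_j(𝒞) is finite. Given L₀ ∈ 𝒞(S, p+1) with S long, cut S ∩ L₀
-- into blocks of d + 1 elements; each block has an infinite 1-closure, in which we choose a
-- new representative. A language missing a representative misses two elements of its block,
-- so every L ∈ 𝒞(S, p+1) is p-close to the representatives, whose p-closure is then inside
-- the finite (p+1)-closure of S; hence there are at most NC_p representatives.
-- Outputting a new element of the closure of the input at the largest level j with
-- NC_j < |input| then generates for every noise level once the input is long enough.
-- Conversely, let G generate with noise i ≥ 1 from time t⋆, and let |S| > t⋆ have a finite
-- 1-closure. Let P list S together with its closure. Every L ∈ 𝒞(S,1) has an enumeration
-- starting with P whose noise lies in S ∖ L, so G(P) lies in every such L, hence in the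
-- closure ⊆ P, although G(P) ∉ P.
-- The separating collection views U as ℕ × ℕ and consists of the languages "columns below n
-- except column j": the first element of a noiseless enumeration reveals a good column, but
-- the points (m, 0), m < n, are 1-close to all these languages, whose intersection is empty.

open import Defs
open import Level using (0ℓ; lift; lower) renaming (suc to lsuc)
open import Axiom.ExcludedMiddle using (ExcludedMiddle)
open import Axiom.DoubleNegationElimination using (DoubleNegationElimination; em⇒dne)
open import Data.Nat using (ℕ; zero; suc; _+_; _*_; _∸_; _≤_; _<_; z≤n; s≤s; _<?_; _≟_)
open import Data.Nat.Properties
  using (module ≤-Reasoning; ≤-refl; ≤-trans; <-≤-trans; ≤-pred; <-cmp; <⇒≢; <⇒≱; ≮⇒≥; ≰⇒>; ≤∧≢⇒<;
         n≤1+n; 1+n≰n; m≤m+n; m≤n+m; m+n≤o⇒m≤o; m≤n⇒m⊓n≡m; m+n∸m≡n; ∸-monoˡ-≤;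
         +-mono-≤; +-monoʳ-≤; +-cancelʳ-≤; +-suc; +-comm; +-identityʳ; *-suc; suc-injective)
open import Data.Nat.ListAction using (sum)
open import Data.List
  using (List; []; _∷_; _++_; _∷ʳ_; length; applyUpTo; map; take; drop; filter; deduplicate)
open import Data.List.Properties
  using (length-++; length-drop; length-take; length-applyUpTo; applyUpTo-∷ʳ; take++drop≡id;
         filter-++; filter-accept; filter-reject)
open import Data.List.Membership.Propositional using (_∈_; _∉_)
open import Data.List.Membership.Propositional.Properties
  using (∈-++⁺ˡ; ∈-++⁺ʳ; ∈-map⁺; ∈-applyUpTo⁺; ∈-applyUpTo⁻; ∈-filter⁺; ∈-filter⁻;
         ∈-deduplicate⁺; ∈-deduplicate⁻)
open import Data.List.Relation.Unary.Any using (here; there)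
import Data.List.Relation.Unary.All as All
open import Data.List.Relation.Unary.AllPairs using ([]; _∷_)
open import Data.List.Relation.Unary.Unique.Propositional using (Unique)
import Data.List.Relation.Unary.Unique.Propositional.Properties as Unique
open import Data.List.Relation.Unary.Unique.DecPropositional.Properties using (deduplicate-!)
open import Data.Product using (Σ; ∃; ∃₂; _×_; _,_; proj₁; proj₂)
open import Data.Sum using (_⊎_; inj₁; inj₂; [_,_])
import Data.Sum as Sum
open import Data.Empty using (⊥-elim)
open import Function using (id; _∘_; case_of_)
open import Function.Bundles using (_↔_; _⇔_; mk⇔; Inverse)
open import Relation.Nullary using (¬_; Dec; yes; no)
import Relation.Nullary.Decidable as Dec
open import Relation.Unary using (Decidable; _≐_)
open import Relation.Binary.Definitions using (DecidableEquality; tri<; tri≈; tri>)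
open import Relation.Binary.PropositionalEquality using (_≡_; _≢_; refl; sym; trans; cong; subst)

module _ {A : Set} where

  ∈⇒∃-removal : ∀ {x : A} {ys} → x ∈ ys →
    ∃ λ ys′ → length ys ≡ suc (length ys′) × (∀ {z} → z ∈ ys → z ≢ x → z ∈ ys′)
  ∈⇒∃-removal {ys = y ∷ ys} (here refl) = ys , refl , λ where
    (here refl) z≢x → ⊥-elim (z≢x refl)
    (there z∈)  _   → z∈
  ∈⇒∃-removal {ys = y ∷ ys} (there x∈) =
    let ys′ , eq , keep = ∈⇒∃-removal x∈ in
    y ∷ ys′ , cong suc eq , λ where
      (here refl) _   → here refl
      (there z∈)  z≢x → there (keep z∈ z≢x)

  unique-⊆⇒length-≤ : ∀ {xs ys : List A} → Unique xs → (∀ {z} → z ∈ xs → z ∈ ys) →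
                      length xs ≤ length ys
  unique-⊆⇒length-≤ [] _ = z≤n
  unique-⊆⇒length-≤ {x ∷ xs} (x∉xs ∷ uxs) xs⊆ys =
    let ys′ , eq , keep = ∈⇒∃-removal (xs⊆ys (here refl)) in
    subst (suc (length xs) ≤_) (sym eq)
      (s≤s (unique-⊆⇒length-≤ uxs λ z∈ → keep (xs⊆ys (there z∈)) λ { refl → All.lookup x∉xs z∈ refl }))

  fresh⇒injective : (f : ℕ → A) → (∀ n → f n ∉ applyUpTo f n) → ∀ j k → f j ≡ f k → j ≡ k
  fresh⇒injective f fresh j k eq with <-cmp j k
  ... | tri< j<k _ _ = ⊥-elim (fresh k (subst (_∈ applyUpTo f k) eq (∈-applyUpTo⁺ f j<k)))
  ... | tri≈ _ j≡k _ = j≡k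
  ... | tri> _ _ k<j = ⊥-elim (fresh j (subst (_∈ applyUpTo f j) (sym eq) (∈-applyUpTo⁺ f k<j)))

∈⇒≤sum : ∀ {n ns} → n ∈ ns → n ≤ sum ns
∈⇒≤sum {ns = n ∷ ns} (here refl) = m≤m+n n (sum ns)
∈⇒≤sum {ns = m ∷ ns} (there n∈) = ≤-trans (∈⇒≤sum n∈) (m≤n+m (sum ns) m)

m+m≤1+n⇒m≤n : ∀ m n → m + m ≤ suc n → m ≤ n
m+m≤1+n⇒m≤n zero    n _ = z≤n
m+m≤1+n⇒m≤n (suc m) n (s≤s le) = ≤-trans (m≤n+m (suc m) m) le

module _ {P : ℕ → Set} (P? : Decidable P) where

  largest : ℕ → ℕ
  largest zero = zero
  largest (suc n) with P? (suc n)
  ... | yes _ = suc n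
  ... | no _ = largest n

  largest-spec : ∀ {j n} → j ≤ n → P j → j ≤ largest n × P (largest n)
  largest-spec {n = zero} z≤n Pj = z≤n , Pj
  largest-spec {j} {suc n} j≤1+n Pj with P? (suc n)
  ... | yes P1+n = j≤1+n , P1+n
  ... | no ¬P1+n = largest-spec (≤-pred (≤∧≢⇒< j≤1+n λ { refl → ¬P1+n Pj })) Pj

module _ {U : Set} where

  record IsEnumeration (R : U → Set) (x : ℕ → U) : Set where
    field
      injective : ∀ j k → x j ≡ x k → j ≡ k
      sound     : ∀ n → R (x n)
      complete  : ∀ u → R u → Range x u

  open IsEnumeration

  IsEnumeration-resp : ∀ {R R′ x} → (∀ {u} → R u → R′ u) → (∀ {u} → R′ u → R u) →
                       IsEnumeration R x → IsEnumeration R′ x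
  IsEnumeration-resp R⊆R′ R′⊆R e = record
    { injective = injective e ; sound = R⊆R′ ∘ sound e ; complete = λ u → complete e u ∘ R′⊆R }

  _++ˢ_ : List U → (ℕ → U) → ℕ → U
  ([] ++ˢ g) n = g n
  ((p ∷ P) ++ˢ g) zero = p
  ((p ∷ P) ++ˢ g) (suc n) = (P ++ˢ g) n

  applyUpTo-++ˢ : ∀ P g → applyUpTo (P ++ˢ g) (length P) ≡ P
  applyUpTo-++ˢ [] g = refl
  applyUpTo-++ˢ (p ∷ P) g = cong (p ∷_) (applyUpTo-++ˢ P g)

  ++ˢ-isEnumeration : ∀ {R g} P → Unique P → (∀ {u} → R u → u ∉ P) →
                      IsEnumeration R g → IsEnumeration (λ u → u ∈ P ⊎ R u) (P ++ˢ g)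
  ++ˢ-isEnumeration [] _ _ e = IsEnumeration-resp inj₂ [ (λ ()) , (λ r → r) ] e
  ++ˢ-isEnumeration {R} {g} (p ∷ P) (p∉P ∷ uP) R∉ e = record
    { injective = inj ; sound = snd ; complete = cmp }
    where
    e′ = ++ˢ-isEnumeration P uP (λ r → R∉ r ∘ there) e
    p∉ : ∀ n → p ≢ (P ++ˢ g) n
    p∉ n eq with sound e′ n
    ... | inj₁ m = All.lookup p∉P m eq
    ... | inj₂ r = R∉ r (here (sym eq))
    inj : ∀ j k → ((p ∷ P) ++ˢ g) j ≡ ((p ∷ P) ++ˢ g) k → j ≡ k
    inj zero    zero    _  = refl
    inj zero    (suc k) eq = ⊥-elim (p∉ k eq)
    inj (suc j) zero    eq = ⊥-elim (p∉ j (sym eq))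
    inj (suc j) (suc k) eq = cong suc (injective e′ j k eq)
    snd : ∀ n → ((p ∷ P) ++ˢ g) n ∈ p ∷ P ⊎ R (((p ∷ P) ++ˢ g) n)
    snd zero    = inj₁ (here refl)
    snd (suc n) = Sum.map₁ there (sound e′ n)
    later : ∀ {u} → Range (P ++ˢ g) u → Range ((p ∷ P) ++ˢ g) u
    later (j , eq) = suc j , eq
    cmp : ∀ u → u ∈ p ∷ P ⊎ R u → Range ((p ∷ P) ++ˢ g) u
    cmp u (inj₁ (here refl)) = zero , refl
    cmp u (inj₁ (there m))   = later (complete e′ u (inj₁ m))
    cmp u (inj₂ r)           = later (complete e′ u (inj₂ r))

  ⊆⇒CloseTo : ∀ {i} {S : List U} {L : U → Set} → (∀ {u} → u ∈ S → L u) → CloseTo i S L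
  ⊆⇒CloseTo S⊆L = [] , z≤n , λ u (u∈S , ¬Lu) → ⊥-elim (¬Lu (S⊆L u∈S))

  CloseTo-mono : ∀ {i j} {S : List U} {L : U → Set} → i ≤ j → CloseTo i S L → CloseTo j S L
  CloseTo-mono i≤j (ys , |ys|≤i , cover) = ys , ≤-trans |ys|≤i i≤j , cover

  CloseTo-⊆ : ∀ {i} {S S′ : List U} {L : U → Set} → (∀ {u} → u ∈ S′ → u ∈ S) →
              CloseTo i S L → CloseTo i S′ L
  CloseTo-⊆ S′⊆S (ys , |ys|≤i , cover) = ys , |ys|≤i , λ u (u∈S′ , ¬Lu) → cover u (S′⊆S u∈S′ , ¬Lu)

  enumeration-noise : ∀ {i} {L : U → Set} {P x} → IsEnumeration (λ u → u ∈ P ⊎ L u) x →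
                      AtMost i (λ u → u ∈ P × ¬ L u) → EnumerationWithNoise i L x
  enumeration-noise e (ys , |ys|≤i , cover) =
    injective e , (λ u → complete e u ∘ inj₂) , ys , |ys|≤i ,
    λ where u ((j , refl) , ¬Lu) → cover u ([ id , ⊥-elim ∘ ¬Lu ] (sound e j) , ¬Lu)

  NCBound : Collection {U} → ℕ → ℕ → Set₁
  NCBound C i N = ∀ S → NoDup S → CSNonEmpty C S i → FiniteSet₁ (Closure C S i) → length S ≤ N

  NCBound-antitone : ∀ {C : Collection {U}} {i j N} → i ≤ j → NCBound C j N → NCBound C i N
  NCBound-antitone i≤j bound S uS (L , CL , cl) (F , cover) =
    bound S uS (L , CL , CloseTo-mono i≤j cl)
      (F , λ z z∈⟨S⟩ⱼ → cover z ((L , CL , cl) , λ L′ CL′ cl′ →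
                                  proj₂ z∈⟨S⟩ⱼ L′ CL′ (CloseTo-mono i≤j cl′)))

noiseDependent⇒uniform : ∀ {U} {C : Collection {U}} i →
  UniformlyNoiseDependentlyGeneratable C → UniformlyGeneratableWithNoise i C
noiseDependent⇒uniform i (G , gen) = G , gen i

cantorStep : ℕ × ℕ → ℕ × ℕ
cantorStep (a , suc b) = suc a , b
cantorStep (a , zero)  = zero , suc a

unpair : ℕ → ℕ × ℕ
unpair zero    = 0 , 0
unpair (suc n) = cantorStep (unpair n)

unpair-surjective : ∀ a b → ∃ λ n → unpair n ≡ (a , b)
unpair-surjective a b = onDiagonal (a + b) a b refl
  where
  onDiagonal : ∀ s a b → a + b ≡ s → ∃ λ n → unpair n ≡ (a , b)
  onDiagonal s (suc a) b eq =
    let n , e = onDiagonal s a (suc b) (trans (+-suc a b) eq) in suc n , cong cantorStep e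
  onDiagonal (suc s) zero (suc b) eq =
    let n , e = onDiagonal s b zero (trans (+-identityʳ b) (suc-injective eq))
    in suc n , cong cantorStep e
  onDiagonal zero    zero zero    _  = 0 , refl
  onDiagonal zero    zero (suc b) ()
  onDiagonal (suc s) zero zero    ()

module _ (em : ExcludedMiddle (lsuc 0ℓ)) where

  dec : (P : Set) → Dec P
  dec P = Dec.map′ lower lift em

  dne₀ : DoubleNegationElimination 0ℓ
  dne₀ = em⇒dne (λ {P} → dec P)

  dne₁ : DoubleNegationElimination (lsuc 0ℓ)
  dne₁ = em⇒dne em

  module _ {U : Set} where

    ¬finite⇒∃∉ : ∀ {ℓ} {P : U → Set ℓ} → DoubleNegationElimination ℓ →
                 ¬ (Σ (List U) λ xs → ∀ u → P u → u ∈ xs) →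
                 (xs : List U) → Σ U λ u → P u × u ∉ xs
    ¬finite⇒∃∉ dne infinite xs =
      dne λ ∄ → infinite (xs , λ u Pu → dne₀ λ u∉xs → ∄ (u , Pu , u∉xs))

    record Listing (P : U → Set₁) : Set₁ where
      field
        members        : List U
        members-unique : Unique members
        member⇒P       : ∀ {u} → u ∈ members → P u
        P⇒member       : ∀ {u} → P u → u ∈ members

    listing : {P : U → Set₁} → FiniteSet₁ P → Listing P
    listing {P} (F , cover) = record
      { members        = deduplicate _≡?_ (filter P? F)
      ; members-unique = deduplicate-! _≡?_ (filter P? F)
      ; member⇒P       = proj₂ ∘ ∈-filter⁻ P? {xs = F} ∘ ∈-deduplicate⁻ _≡?_ (filter P? F)
      ; P⇒member       = λ Pu → ∈-deduplicate⁺ _≡?_ (∈-filter⁺ P? (cover _ Pu) Pu)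
      }
      where
      P? : Decidable P
      P? u = em
      _≡?_ : DecidableEquality U
      u ≡? v = dec (u ≡ v)

    choose : {P : U → Set₁} → U → Dec (Σ U P) → U
    choose _  (yes (u , _)) = u
    choose u₀ (no _)        = u₀

    choose-spec : ∀ {P : U → Set₁} u₀ (d : Dec (Σ U P)) → Σ U P → P (choose u₀ d)
    choose-spec _ (yes (_ , Pu)) _  = Pu
    choose-spec _ (no ¬∃P)       ∃P = ⊥-elim (¬∃P ∃P)

    outside : (U → Set) → List U → List U
    outside L = filter (λ u → dec (¬ L u))

    length-outside-≤ : ∀ {i} {S : List U} {L} → Unique S → CloseTo i S L → length (outside L S) ≤ i
    length-outside-≤ uS (ys , |ys|≤i , cover) =
      ≤-trans (unique-⊆⇒length-≤ (Unique.filter⁺ _ uS) (cover _ ∘ ∈-filter⁻ _)) |ys|≤i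

    outside-CloseTo : ∀ {i} {S : List U} {L} → length (outside L S) ≤ i → CloseTo i S L
    outside-CloseTo {S = S} {L} ≤i = outside L S , ≤i , λ u (u∈S , ¬Lu) → ∈-filter⁺ _ u∈S ¬Lu

    length-outside-++ : ∀ L (xs ys : List U) →
                        length (outside L (xs ++ ys)) ≡ length (outside L xs) + length (outside L ys)
    length-outside-++ L xs ys = trans (cong length (filter-++ _ xs ys)) (length-++ (outside L xs))

    outside-∷-∈ : ∀ {L : U → Set} {z} xs → L z → outside L (z ∷ xs) ≡ outside L xs
    outside-∷-∈ {L} _ Lz = filter-reject (λ u → dec (¬ L u)) (λ ¬Lz → ¬Lz Lz)

    outside-∷-∉ : ∀ {L : U → Set} {z} xs → ¬ L z → outside L (z ∷ xs) ≡ z ∷ outside L xs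
    outside-∷-∉ {L} _ ¬Lz = filter-accept (λ u → dec (¬ L u)) ¬Lz

    module _ (w : ℕ → U) (w-onto : ∀ u → ∃ λ n → w n ≡ u) where

      module _ {R : U → Set} (R-infinite : Infinite R) where

        -- Step n lists w n if it is a new element of R, and otherwise any new element of R;
        -- so each element w n of R is listed by step n.
        private
          Wish : List U → ℕ → Set
          Wish seen n = R (w n) × w n ∉ seen

          step : ∀ seen n → Dec (Wish seen n) → Σ U λ u → R u × u ∉ seen
          step seen n (yes wish) = w n , wish
          step seen n (no _)     = ¬finite⇒∃∉ dne₀ R-infinite seen

          step-wish : ∀ seen n d → Wish seen n → proj₁ (step seen n d) ≡ w n
          step-wish seen n (yes _)     _    = refl
          step-wish seen n (no ¬wish) wish = ⊥-elim (¬wish wish)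

          next : ∀ seen n → Σ U λ u → R u × u ∉ seen
          next seen n = step seen n (dec (Wish seen n))

          listed : ℕ → List U
          listed zero    = []
          listed (suc n) = listed n ∷ʳ proj₁ (next (listed n) n)

        enumerate : ℕ → U
        enumerate n = proj₁ (next (listed n) n)

        private
          listed≡ : ∀ n → listed n ≡ applyUpTo enumerate n
          listed≡ zero    = refl
          listed≡ (suc n) = trans (cong (_∷ʳ enumerate n) (listed≡ n)) (applyUpTo-∷ʳ enumerate n)

          enumerate-fresh : ∀ n → enumerate n ∉ applyUpTo enumerate n
          enumerate-fresh n = subst (enumerate n ∉_) (listed≡ n) (proj₂ (proj₂ (next (listed n) n)))

          enumerate-complete : ∀ u → R u → Range enumerate u
          enumerate-complete u Ru with n , refl ← w-onto u | dec (w n ∈ applyUpTo enumerate n)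
          ... | yes seen = let j , _ , eq = ∈-applyUpTo⁻ enumerate seen in j , sym eq
          ... | no unseen =
            n , step-wish (listed n) n (dec (Wish (listed n) n))
                  (Ru , subst (w n ∉_) (sym (listed≡ n)) unseen)

        enumerate-isEnumeration : IsEnumeration R enumerate
        enumerate-isEnumeration = record
          { injective = fresh⇒injective enumerate enumerate-fresh
          ; sound     = λ n → proj₁ (proj₂ (next (listed n) n))
          ; complete  = enumerate-complete
          }

      enumerationWithPrefix : ∀ {L : U → Set} → Infinite L → (P : List U) → Unique P →
        Σ (ℕ → U) λ x → applyUpTo x (length P) ≡ P × IsEnumeration (λ u → u ∈ P ⊎ L u) x
      enumerationWithPrefix {L} L-infinite P uP =
        P ++ˢ enumerate L∖P-infinite , applyUpTo-++ˢ P _ ,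
        IsEnumeration-resp (Sum.map₂ proj₁) split
          (++ˢ-isEnumeration P uP proj₂ (enumerate-isEnumeration L∖P-infinite))
        where
        split : ∀ {u} → u ∈ P ⊎ L u → u ∈ P ⊎ (L u × u ∉ P)
        split (inj₁ u∈P) = inj₁ u∈P
        split {u} (inj₂ Lu) with dec (u ∈ P)
        ... | yes u∈P = inj₁ u∈P
        ... | no  u∉P = inj₂ (Lu , u∉P)
        L∖P-infinite : Infinite (λ u → L u × u ∉ P)
        L∖P-infinite (xs , cover) = L-infinite (P ++ xs , λ u Lu →
          [ ∈-++⁺ˡ , ∈-++⁺ʳ P ∘ cover u ] (split (inj₂ Lu)))

      generates-on-prefix : ∀ {i} {C : Collection {U}} {G K} {P : List U} →
        IsCollectionOfLanguages C → (G-gen : UniformlyGeneratesWithNoise i C G) →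
        C K → Unique P → proj₁ G-gen < length P → AtMost i (λ u → u ∈ P × ¬ K u) →
        K (G P) × G P ∉ P
      generates-on-prefix {P = []} _ _ _ _ () _
      generates-on-prefix {G = G} {K} {P@(_ ∷ P′)} isL (t⋆ , gen) CK uP (s≤s t⋆≤|P′|) P-noise =
        subst K G[x]≡G[P] (proj₁ generated) ,
        λ GP∈P → let j , j<|P| , GP≡xj = ∈-applyUpTo⁻ x (subst (G P ∈_) (sym x-prefix) GP∈P)
                 in proj₂ generated j (≤-pred j<|P|) (trans G[x]≡G[P] GP≡xj)
        where
        x-enum = enumerationWithPrefix (isL K CK) P uP
        x = proj₁ x-enum
        x-prefix : applyUpTo x (length P) ≡ P
        x-prefix = proj₁ (proj₂ x-enum)
        generated : GeneratesAt G K x (length P′)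
        generated = gen K CK x (enumeration-noise (proj₂ (proj₂ x-enum)) P-noise) (length P′) t⋆≤|P′|
        G[x]≡G[P] : output G x (length P′) ≡ G P
        G[x]≡G[P] = cong G x-prefix

      uniform⇒NC₁-finite : ∀ {i} {C : Collection {U}} → IsCollectionOfLanguages C → 1 ≤ i →
                           UniformlyGeneratableWithNoise i C → NCFinite 1 C
      uniform⇒NC₁-finite {i} {C} isL 1≤i (G , G-gen) =
        t⋆ , λ S uS C[S]≢∅ finite → ≮⇒≥ (¬t⋆<|S| S uS C[S]≢∅ finite)
        where
        t⋆ = proj₁ G-gen
        ¬t⋆<|S| : ∀ S → Unique S → CSNonEmpty C S 1 → FiniteSet₁ (Closure C S 1) → ¬ t⋆ < length S
        ¬t⋆<|S| S uS C[S]≢∅@(L₀ , CL₀ , cl₀) (F , cover) t⋆<|S| = proj₂ (generated CL₀ cl₀) G[P]∈P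
          where
          open Listing (listing {P = λ u → u ∈ S ⊎ Closure C S 1 u}
                                (S ++ F , λ u → [ ∈-++⁺ˡ , ∈-++⁺ʳ S ∘ cover u ]))
            renaming (members to P)
          P-noise : ∀ {L} → C L → CloseTo 1 S L → AtMost i (λ u → u ∈ P × ¬ L u)
          P-noise CL cl@(ys , |ys|≤1 , S∖L⊆ys) = ys , ≤-trans |ys|≤1 1≤i , λ u (u∈P , ¬Lu) →
            S∖L⊆ys u ([ id , (λ u∈⟨S⟩ → ⊥-elim (¬Lu (proj₂ u∈⟨S⟩ _ CL cl))) ] (member⇒P u∈P) , ¬Lu)
          generated : ∀ {L} → C L → CloseTo 1 S L → L (G P) × G P ∉ P
          generated CL cl = generates-on-prefix {G = G} isL G-gen CL members-unique
            (<-≤-trans t⋆<|S| (unique-⊆⇒length-≤ uS (P⇒member ∘ inj₁))) (P-noise CL cl)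
          G[P]∈P : G P ∈ P
          G[P]∈P = P⇒member (inj₂ (C[S]≢∅ , λ L CL cl → proj₁ (generated CL cl)))

    closure-∃∉ : ∀ {C : Collection {U}} {j N S} → NCBound C j N → Unique S → CSNonEmpty C S j →
                      N < length S → (xs : List U) → Σ U λ z → Closure C S j z × z ∉ xs
    closure-∃∉ bound uS C[S]≢∅ N<|S| = ¬finite⇒∃∉ dne₁ (<⇒≱ N<|S| ∘ bound _ uS C[S]≢∅)

    outside-closure-≥2 : ∀ {C : Collection {U}} {D L z} → C L → Closure C D 1 z → ¬ L z →
                         2 ≤ length (outside L D)
    outside-closure-≥2 CL z∈⟨D⟩ ¬Lz = ≰⇒> λ ≤1 → ¬Lz (proj₂ z∈⟨D⟩ _ CL (outside-CloseTo ≤1))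

    module _ {C : Collection {U}} {d} (NC₁≤d : NCBound C 1 d) where

      module _ {L₀} (CL₀ : C L₀) where

        record Representatives (m : ℕ) (xs : List U) : Set₁ where
          field
            reps         : List U
            length-reps  : length reps ≡ m
            unique-reps  : Unique reps
            reps⊆L₀      : ∀ {u} → u ∈ reps → L₀ u
            outside-reps : ∀ {L} → C L →
                           length (outside L reps) + length (outside L reps) ≤ length (outside L xs)

        open Representatives

        representatives : ∀ m xs → Unique xs → (∀ {u} → u ∈ xs → L₀ u) → suc d * m ≤ length xs →
                          Representatives m xs
        representatives zero xs _ _ _ = record
          { reps = [] ; length-reps = refl ; unique-reps = []
          ; reps⊆L₀ = λ () ; outside-reps = λ _ → z≤n }
        representatives (suc m) xs uxs xs⊆L₀ long = record
          { reps         = z ∷ reps rest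
          ; length-reps  = cong suc (length-reps rest)
          ; unique-reps  = All.tabulate (λ v∈ z≡v → z∉rest (subst (_∈ reps rest) (sym z≡v) v∈))
                           ∷ unique-reps rest
          ; reps⊆L₀      = λ { (here refl) → proj₂ z∈⟨D⟩ L₀ CL₀ D-close ; (there u∈) → reps⊆L₀ rest u∈ }
          ; outside-reps = counted
          }
          where
          open ≤-Reasoning
          k = suc d
          D = take k xs
          long′ : k + k * m ≤ length xs
          long′ = subst (_≤ length xs) (*-suc k m) long
          D⊆xs : ∀ {u} → u ∈ D → u ∈ xs
          D⊆xs {u} = subst (u ∈_) (take++drop≡id k xs) ∘ ∈-++⁺ˡ
          D-close : CloseTo 1 D L₀
          D-close = ⊆⇒CloseTo (xs⊆L₀ ∘ D⊆xs)
          d<|D| : d < length D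
          d<|D| = subst (d <_) (sym (trans (length-take k xs) (m≤n⇒m⊓n≡m (m+n≤o⇒m≤o k long′)))) ≤-refl
          rest-long : k * m ≤ length (drop k xs)
          rest-long = begin
            k * m               ≡⟨ m+n∸m≡n k (k * m) ⟨
            k + k * m ∸ k       ≤⟨ ∸-monoˡ-≤ k long′ ⟩
            length xs ∸ k       ≡⟨ length-drop k xs ⟨
            length (drop k xs)  ∎
          rest : Representatives m (drop k xs)
          rest = representatives m (drop k xs) (Unique.drop⁺ k uxs)
                   (λ {u} → xs⊆L₀ ∘ subst (u ∈_) (take++drop≡id k xs) ∘ ∈-++⁺ʳ D) rest-long
          new = closure-∃∉ NC₁≤d (Unique.take⁺ k uxs) (L₀ , CL₀ , D-close) d<|D| (reps rest)
          z = proj₁ new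
          z∈⟨D⟩ = proj₁ (proj₂ new)
          z∉rest = proj₂ (proj₂ new)
          counted : ∀ {L} → C L → length (outside L (z ∷ reps rest)) + length (outside L (z ∷ reps rest))
                                  ≤ length (outside L xs)
          counted {L} CL = begin
            b′ + b′                              ≤⟨ z-counted ⟩
            length (outside L D) + r             ≡⟨ length-outside-++ L D (drop k xs) ⟨
            length (outside L (D ++ drop k xs))  ≡⟨ cong (length ∘ outside L) (take++drop≡id k xs) ⟩
            length (outside L xs)                ∎
            where
            b′ = length (outside L (z ∷ reps rest))
            b = length (outside L (reps rest))
            r = length (outside L (drop k xs))
            z-counted : b′ + b′ ≤ length (outside L D) + r
            z-counted with dec (L z)
            ... | yes Lz = begin
              b′ + b′                   ≡⟨ cong (λ n → n + n) (cong length (outside-∷-∈ _ Lz)) ⟩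
              b + b                     ≤⟨ outside-reps rest CL ⟩
              r                         ≤⟨ m≤n+m r _ ⟩
              length (outside L D) + r  ∎
            ... | no ¬Lz = begin
              b′ + b′                   ≡⟨ cong (λ n → n + n) (cong length (outside-∷-∉ _ ¬Lz)) ⟩
              suc b + suc b             ≡⟨ cong suc (+-suc b b) ⟩
              2 + (b + b)               ≤⟨ +-mono-≤ (outside-closure-≥2 CL z∈⟨D⟩ ¬Lz) (outside-reps rest CL) ⟩
              length (outside L D) + r  ∎

      open Representatives

      NCBound-step : ∀ {p N} → NCBound C p N → NCBound C (suc p) (suc p + suc d * suc N)
      NCBound-step {p} {N} NCp≤N S uS (L₀ , CL₀ , cl₀@(ys , |ys|≤1+p , S∖L₀⊆ys)) (F , cover) =
        ≮⇒≥ λ long → let T = representatives CL₀ (suc N) S₀ uS₀ S₀⊆L₀ (|S₀|≥ long)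
                     in 1+n≰n (subst (_≤ N) (length-reps T) (|T|≤N T))
        where
        open ≤-Reasoning
        L₀? : Decidable L₀
        L₀? u = dec (L₀ u)
        S₀ = filter L₀? S
        uS₀ : Unique S₀
        uS₀ = Unique.filter⁺ L₀? uS
        S₀⊆S : ∀ {u} → u ∈ S₀ → u ∈ S
        S₀⊆S = proj₁ ∘ ∈-filter⁻ L₀? {xs = S}
        S₀⊆L₀ : ∀ {u} → u ∈ S₀ → L₀ u
        S₀⊆L₀ = proj₂ ∘ ∈-filter⁻ L₀? {xs = S}
        |S|≤ : length S ≤ length S₀ + suc p
        |S|≤ = begin
          length S               ≤⟨ unique-⊆⇒length-≤ uS S⊆S₀++ys ⟩
          length (S₀ ++ ys)      ≡⟨ length-++ S₀ ⟩
          length S₀ + length ys  ≤⟨ +-monoʳ-≤ (length S₀) |ys|≤1+p ⟩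
          length S₀ + suc p      ∎
          where
          S⊆S₀++ys : ∀ {u} → u ∈ S → u ∈ S₀ ++ ys
          S⊆S₀++ys {u} u∈S with dec (L₀ u)
          ... | yes L₀u = ∈-++⁺ˡ (∈-filter⁺ L₀? u∈S L₀u)
          ... | no ¬L₀u = ∈-++⁺ʳ S₀ (S∖L₀⊆ys u (u∈S , ¬L₀u))
        |S₀|≥ : suc p + suc d * suc N < length S → suc d * suc N ≤ length S₀
        |S₀|≥ long = +-cancelʳ-≤ (suc p) _ _ (begin
          suc d * suc N + suc p        ≡⟨ +-comm (suc d * suc N) (suc p) ⟩
          suc p + suc d * suc N        ≤⟨ n≤1+n _ ⟩
          suc (suc p + suc d * suc N)  ≤⟨ long ⟩
          length S                     ≤⟨ |S|≤ ⟩
          length S₀ + suc p            ∎)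
        T-close : (T : Representatives CL₀ (suc N) S₀) → ∀ {L} → C L →
                  CloseTo (suc p) S L → CloseTo p (reps T) L
        T-close T CL cl = outside-CloseTo (m+m≤1+n⇒m≤n _ p
          (≤-trans (outside-reps T CL) (length-outside-≤ uS₀ (CloseTo-⊆ S₀⊆S cl))))
        |T|≤N : (T : Representatives CL₀ (suc N) S₀) → length (reps T) ≤ N
        |T|≤N T = NCp≤N (reps T) (unique-reps T) (L₀ , CL₀ , ⊆⇒CloseTo (reps⊆L₀ T))
          (F , λ z z∈⟨T⟩ → cover z ((L₀ , CL₀ , cl₀) , λ L CL cl → proj₂ z∈⟨T⟩ L CL (T-close T CL cl)))

    NC₁-finite⇒NC-finite : ∀ {C : Collection {U}} → NCFinite 1 C → ∀ j → NCFinite j C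
    NC₁-finite⇒NC-finite (d , NC₁≤d) zero = d , NCBound-antitone z≤n NC₁≤d
    NC₁-finite⇒NC-finite NC₁@(d , NC₁≤d) (suc p) =
      let N , NCp≤N = NC₁-finite⇒NC-finite NC₁ p in suc p + suc d * suc N , NCBound-step NC₁≤d NCp≤N

    module _ {C : Collection {U}} (NC : ∀ j → NCFinite j C) (u₀ : U) where

      private
        N : ℕ → ℕ
        N j = proj₁ (NC j)

        level : List U → ℕ
        level S = largest (λ j → N j <? length S) (length S)

        Fresh : List U → U → Set₁
        Fresh S z = Closure C S (level S) z × z ∉ S

      closureGenerator : Generator
      closureGenerator S = choose u₀ (em {Σ U (Fresh S)})

      closureGenerator-generates : ∀ n⋆ K → C K → ∀ x → EnumerationWithNoise n⋆ K x →
                                   ∀ t → n⋆ + N n⋆ ≤ t → GeneratesAt closureGenerator K x t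
      closureGenerator-generates n⋆ K CK x (x-inj , _ , ys , |ys|≤n⋆ , noise⊆ys) t n⋆+N≤t =
        proj₂ (proj₁ fresh) K CK K-close ,
        λ j j≤t eq → proj₂ fresh (subst (_∈ S) (sym eq) (∈-applyUpTo⁺ x (s≤s j≤t)))
        where
        S = applyUpTo x (suc t)
        |S|≡ : length S ≡ suc t
        |S|≡ = length-applyUpTo x (suc t)
        uS : Unique S
        uS = Unique.applyUpTo⁺₁ x (suc t) λ i<j _ eq → <⇒≢ i<j (x-inj _ _ eq)
        level-spec : n⋆ ≤ level S × N (level S) < length S
        level-spec = largest-spec (λ j → N j <? length S)
          (subst (n⋆ ≤_) (sym |S|≡) (≤-trans (m≤m+n n⋆ (N n⋆)) (≤-trans n⋆+N≤t (n≤1+n t))))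
          (subst (N n⋆ <_) (sym |S|≡) (s≤s (≤-trans (m≤n+m (N n⋆) n⋆) n⋆+N≤t)))
        K-close : CloseTo (level S) S K
        K-close = ys , ≤-trans |ys|≤n⋆ (proj₁ level-spec) , λ u (u∈S , ¬Ku) →
          let i , _ , u≡xi = ∈-applyUpTo⁻ x u∈S in noise⊆ys u ((i , sym u≡xi) , ¬Ku)
        fresh : Fresh S (closureGenerator S)
        fresh = choose-spec u₀ em
          (closure-∃∉ (proj₂ (NC (level S))) uS (K , CK , K-close) (proj₂ level-spec) S)

      closureGenerator-noiseDependent : UniformlyNoiseDependentlyGeneratable C
      closureGenerator-noiseDependent =
        closureGenerator , λ n⋆ → n⋆ + N n⋆ , closureGenerator-generates n⋆

    NC₁-finite⇒noiseDependent : ∀ {C : Collection {U}} → U → NCFinite 1 C →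
                                UniformlyNoiseDependentlyGeneratable C
    NC₁-finite⇒noiseDependent u₀ NC₁ = closureGenerator-noiseDependent (NC₁-finite⇒NC-finite NC₁) u₀

  module _ {U : Set} (U↔ℕ : U ↔ ℕ) where

    open Inverse U↔ℕ using (to; from; strictlyInverseˡ; strictlyInverseʳ)

    from-onto : ∀ u → ∃ λ n → from n ≡ u
    from-onto u = to u , strictlyInverseʳ u

    column index : U → ℕ
    column = proj₁ ∘ unpair ∘ to
    index  = proj₂ ∘ unpair ∘ to

    point : ℕ → ℕ → U
    point m k = from (proj₁ (unpair-surjective m k))

    point-coordinates : ∀ m k → unpair (to (point m k)) ≡ (m , k)
    point-coordinates m k = trans (cong unpair (strictlyInverseˡ _)) (proj₂ (unpair-surjective m k))

    point-fresh : ∀ m xs → point m (suc (sum (map index xs))) ∉ xs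
    point-fresh m xs p∈xs =
      1+n≰n (subst (_≤ sum (map index xs)) (cong proj₂ (point-coordinates m _))
                   (∈⇒≤sum (∈-map⁺ index p∈xs)))

    ColumnLanguage : ℕ → ℕ → U → Set
    ColumnLanguage n j u = column u < n × column u ≢ j

    point-∈ : ∀ {n j m} k → m < n → m ≢ j → ColumnLanguage n j (point m k)
    point-∈ {n} {j} {m} k = subst (λ c → c < n → c ≢ j → ColumnLanguage n j (point m k))
      (cong proj₁ (point-coordinates m k)) _,_

    columnCollection : Collection {U}
    columnCollection L = ∃₂ λ n j → L ≐ ColumnLanguage (2 + n) j

    otherColumn : ℕ → ℕ
    otherColumn zero    = 1
    otherColumn (suc _) = 0

    otherColumn-< : ∀ n j → otherColumn j < 2 + n
    otherColumn-< n zero    = s≤s (s≤s z≤n)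
    otherColumn-< n (suc _) = s≤s z≤n

    otherColumn-≢ : ∀ j → otherColumn j ≢ j
    otherColumn-≢ zero    ()
    otherColumn-≢ (suc _) ()

    columnCollection-languages : IsCollectionOfLanguages columnCollection
    columnCollection-languages L (n , j , _ , ⊆L) (xs , cover) =
      point-fresh (otherColumn j) xs (cover _ (⊆L (point-∈ _ (otherColumn-< n j) (otherColumn-≢ j))))

    noiseless⇒⊆ : ∀ {K : U → Set} {x} → EnumerationWithNoise 0 K x → ∀ n → K (x n)
    noiseless⇒⊆ (_ , _ , [] , _ , noise⊆[]) n = dne₀ λ ¬Kxn → case noise⊆[] _ ((n , refl) , ¬Kxn) of λ ()

    sameColumnGenerator : Generator
    sameColumnGenerator []           = from 0  -- never used: the input is x₀, …, x_t
    sameColumnGenerator xs@(x₀ ∷ _) = point (column x₀) (suc (sum (map index xs)))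

    columnCollection-noiseless : UniformlyGeneratableWithNoise 0 columnCollection
    columnCollection-noiseless = sameColumnGenerator , 0 , λ where
      K (n , j , K⊆ , ⊆K) x x-enum t _ →
        let x₀∈ = K⊆ (noiseless⇒⊆ x-enum 0) in
        ⊆K (point-∈ _ (proj₁ x₀∈) (proj₂ x₀∈)) ,
        λ i i≤t eq → point-fresh (column (x 0)) (applyUpTo x (suc t))
                       (subst (_∈ applyUpTo x (suc t)) (sym eq) (∈-applyUpTo⁺ x (s≤s i≤t)))

    columnCollection-¬NC₁ : ¬ NCFinite 1 columnCollection
    columnCollection-¬NC₁ (N , bound) =
      1+n≰n (≤-trans (n≤1+n (suc N))
                     (subst (_≤ N) (length-applyUpTo base (2 + N)) (bound S uS C[S]≢∅ ⟨S⟩-finite)))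
      where
      base : ℕ → U
      base m = point m 0
      column-base : ∀ m → column (base m) ≡ m
      column-base m = cong proj₁ (point-coordinates m 0)
      S = applyUpTo base (2 + N)
      uS : Unique S
      uS = Unique.applyUpTo⁺₁ base (2 + N) λ i<j _ eq →
        <⇒≢ i<j (trans (sym (column-base _)) (trans (cong column eq) (column-base _)))
      all-in : ∀ j → columnCollection (ColumnLanguage (2 + N) j)
      all-in j = N , j , id , id
      S-close : ∀ j → CloseTo 1 S (ColumnLanguage (2 + N) j)
      S-close j = base j ∷ [] , s≤s z≤n , λ u (u∈S , ¬Lu) → case ∈-applyUpTo⁻ base u∈S of λ where
        (i , i<2+N , refl) → case i ≟ j of λ where
          (yes refl) → here refl
          (no i≢j)   → ⊥-elim (¬Lu (point-∈ 0 i<2+N i≢j))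
      C[S]≢∅ : CSNonEmpty columnCollection S 1
      C[S]≢∅ = ColumnLanguage (2 + N) 0 , all-in 0 , S-close 0
      ⟨S⟩-finite : FiniteSet₁ (Closure columnCollection S 1)
      ⟨S⟩-finite = [] , λ z (_ , z∈all) →
        ⊥-elim (proj₂ (z∈all _ (all-in (column z)) (S-close (column z))) refl)

    columnCollection-separates : IsCollectionOfLanguages columnCollection
                               × UniformlyGeneratableWithNoise 0 columnCollection
                               × ¬ UniformlyGeneratableWithNoise 1 columnCollection
    columnCollection-separates =
      columnCollection-languages , columnCollection-noiseless ,
      columnCollection-¬NC₁ ∘ uniform⇒NC₁-finite from from-onto columnCollection-languages ≤-refl

mainTheorem4 : ExcludedMiddle (lsuc 0ℓ) →
    (U : Set) → U ↔ ℕ →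
    ((C : Collection {U}) → IsCollectionOfLanguages C → (i : ℕ) → 1 ≤ i →
      (NCFinite 1 C ⇔ UniformlyGeneratableWithNoise i C)
      × (UniformlyGeneratableWithNoise i C ⇔ UniformlyNoiseDependentlyGeneratable C))
    × Σ (Collection {U}) (λ C → IsCollectionOfLanguages C
        × UniformlyGeneratableWithNoise 0 C
        × ¬ UniformlyGeneratableWithNoise 1 C)
mainTheorem4 em U U↔ℕ =
  (λ C isL i 1≤i →
      mk⇔ (noiseDependent⇒uniform i ∘ NC₁⇒noiseDependent) (uniform⇒NC₁ isL 1≤i)
    , mk⇔ (NC₁⇒noiseDependent ∘ uniform⇒NC₁ isL 1≤i) (noiseDependent⇒uniform i))
  , columnCollection em U↔ℕ , columnCollection-separates em U↔ℕ
  where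
  open Inverse U↔ℕ using (from)
  NC₁⇒noiseDependent : ∀ {C : Collection {U}} → NCFinite 1 C → UniformlyNoiseDependentlyGeneratable C
  NC₁⇒noiseDependent = NC₁-finite⇒noiseDependent em (from 0)
  uniform⇒NC₁ : ∀ {i} {C : Collection {U}} → IsCollectionOfLanguages C → 1 ≤ i →
                UniformlyGeneratableWithNoise i C → NCFinite 1 C
  uniform⇒NC₁ = uniform⇒NC₁-finite em from (from-onto em U↔ℕ)
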